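{- Let $G=Q_n(X)$ be a daisy cube and $ab\in E(G)$. If the notation can be chosen so that $|W_{ab}|\ge|W_{ba}|$, then there exists a proper labelling of $G$ in which the vertex labelled by the all-zero string lies in $W_{ab}$.
   Context: $B=\{0,1\}$; $Q_k$ has vertex set $B^k$ (binary strings of length $k$), two strings adjacent iff they differ in exactly one position. For $u,v\in B^k$ write $u\le v$ if $u_i\le v_i$ for all $i$. For $X\subseteq B^k$ the daisy cube $Q_k(X)$ is the subgraph of $Q_k$ induced by $\{u: u\le x\text{ for some }x\in X\}$. A labelling of a graph $G$ is an isometric embedding $\varphi$ of $G$ into some hypercube $Q_k$; it is proper if $\varphi(V(G))$ is closed downward under $\le$, i.e. $G$ is isomorphic via $\varphi$ to the daisy cube $Q_k(\varphi(V(G)))$. For an edge $ab$ of $G$ (distances in $G$): $W_{ab}=\{w: d(a,w)<d(b,w)\}$, $W_{ba}=\{w: d(b,w)<d(a,w)\}$. -}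

module Defs where

open import Data.Bool using (Bool; true; false)
import Data.Bool as B
open import Data.Nat using (ℕ; zero; suc; _<_; _≤_)
open import Data.Fin using (Fin)
open import Data.Vec using (Vec; lookup; replicate)
open import Data.Vec.Relation.Binary.Pointwise.Inductive using (Pointwise)
open import Data.List using (List; length)
open import Data.List.Membership.Propositional using (_∈_)
open import Data.List.Relation.Unary.Unique.Propositional using (Unique)
open import Data.Product using (Σ; ∃; _×_)
open import Data.Unit using (⊤)
open import Relation.Nullary using (¬_)
open import Relation.Binary.PropositionalEquality using (_≡_; _≢_)
open import Function.Bundles using (_⇔_)

BStr : ℕ → Set
BStr k = Vec Bool k

_≼_ : ∀ {k} → BStr k → BStr k → Set
u ≼ v = Pointwise B._≤_ u v

zeros : ∀ k → BStr k
zeros k = replicate k false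

Adj : ∀ {k} → BStr k → BStr k → Set
Adj {k} u v = Σ (Fin k) λ i → (lookup u i ≢ lookup v i) × (∀ j → j ≢ i → lookup u j ≡ lookup v j)

-- Walks of length m inside the subgraph of Q_k induced by the vertex predicate P.
data Walk {k : ℕ} (P : BStr k → Set) : BStr k → BStr k → ℕ → Set where
  here : ∀ {u} → P u → Walk P u u zero
  step : ∀ {u v w m} → P u → Adj u v → Walk P v w m → Walk P u w (suc m)

Dist : ∀ {k} → (BStr k → Set) → BStr k → BStr k → ℕ → Set
Dist P u v m = Walk P u v m × (∀ m′ → m′ < m → ¬ Walk P u v m′)

Full : ∀ {k} → BStr k → Set
Full _ = ⊤

-- vertex set of the daisy cube Q_n(X)
InDaisy : ∀ {n} → List (BStr n) → BStr n → Set
InDaisy X u = ∃ λ x → x ∈ X × u ≼ x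

W : ∀ {n} → List (BStr n) → BStr n → BStr n → BStr n → Set
W X a b w = InDaisy X w × Σ ℕ λ m → Σ ℕ λ m′ →
  Dist (InDaisy X) a w m × Dist (InDaisy X) b w m′ × m < m′

HasCard : ∀ {n} → (BStr n → Set) → ℕ → Set
HasCard {n} S c = Σ (List (BStr n)) λ l → Unique l × (∀ u → (u ∈ l) ⇔ S u) × length l ≡ c

-- φ : V(Q_n(X)) → V(Q_k) is a labelling (isometric embedding) of G = Q_n(X)
-- (φ is given on all strings; only its values on V(G) matter)
IsLabelling : ∀ {n k} → List (BStr n) → (BStr n → BStr k) → Set
IsLabelling X φ = ∀ u v → InDaisy X u → InDaisy X v → ∀ m →
  Dist (InDaisy X) u v m ⇔ Dist Full (φ u) (φ v) m

IsProper : ∀ {n k} → List (BStr n) → (BStr n → BStr k) → Set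
IsProper X φ = ∀ u → InDaisy X u → ∀ y → y ≼ φ u → ∃ λ v → InDaisy X v × φ v ≡ y

module Submission where

open import Defs
open import Data.Nat using (ℕ; _≤_)
open import Data.List using (List)
open import Data.Product using (Σ; ∃; _×_)
open import Relation.Binary.PropositionalEquality using (_≡_)

open import Data.Nat using (zero; suc; _+_; z≤n; s≤s; _≤?_)
open import Data.Nat.Properties using (n≤1+n; ≤-trans; ≤-reflexive; +-suc; <⇒≱; ≰⇒>; ≤-antisym)
open import Data.Bool using (Bool; true; false; not) renaming (_≟_ to _≟ᵇ_)
import Data.Bool as B
import Data.Bool.Properties as BP
open import Data.Fin using (Fin; zero; suc) renaming (_≟_ to _≟ᶠ_)
open import Data.Vec using ([]; _∷_; lookup)
open import Data.Vec.Properties using (≡-dec; lookup-replicate; tabulate∘lookup; tabulate-cong)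
import Data.Vec.Relation.Binary.Pointwise.Inductive as PW
open import Data.List using ([]; _∷_; _++_; map; length)
open import Data.List.Properties using (length-map; length-++-sucʳ)
open import Data.List.Membership.Propositional using (_∈_)
open import Data.List.Membership.Propositional.Properties using (∈-map⁻; ∈-++⁺ˡ; ∈-++⁺ʳ; ∈-++⁻; ∈-∃++)
import Data.List.Membership.DecPropositional as DecMembership
open import Data.List.Relation.Binary.Subset.Propositional using (_⊆_)
open import Data.List.Relation.Unary.Any using (here; there)
open import Data.List.Relation.Unary.All as All using ()
open import Data.List.Relation.Unary.AllPairs using (_∷_)
import Data.List.Relation.Unary.Unique.Propositional.Properties as UniqueProperties
open import Data.Product using (_,_; proj₁)
open import Data.Sum using (inj₁; inj₂)
open import Data.Empty using (⊥-elim)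
open import Data.Unit using (tt)
open import Relation.Nullary using (yes; no; contradiction)
open import Relation.Binary.Definitions using (DecidableEquality)
open import Data.List.Relation.Unary.Unique.Propositional using (Unique)
open import Relation.Binary.PropositionalEquality using (_≢_; refl; sym; trans; cong; subst; module ≡-Reasoning)
open import Function.Base using (id)
open import Function.Bundles using (_⇔_; mk⇔; Equivalence)
open import Function.Definitions using (Injective)

-- In a down-closed set P of strings the
-- induced subgraph of Q_k is isometric: d_P(u,v) is the Hamming distance,
-- realised by first descending from u and then ascending to v.  Hence every
-- Hamming isometry of strings, in particular the identity and the flip of a
-- coordinate i, is a labelling of the daisy cube G = Q_n(X).  If ab is an edge
-- with a, b differing in coordinate i, then W_ab = {w ∈ G : w_i = a_i}.
--   * If a_i = 0, the identity labelling is proper and 0…0 ∈ W_ab.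
--   * If a_i = 1, flipping coordinate i maps W_ab injectively into W_ba (it
--     moves down, so stays in G); as |W_ba| ≤ |W_ab| it is onto.  Hence G is
--     closed under flipping 0 to 1 at coordinate i, which makes the flipped
--     labelling proper, and the vertex labelled 0…0 is the flip of 0…0 ∈ W_ba.

bitDistance : Bool → Bool → ℕ
bitDistance false false = 0
bitDistance true  true  = 0
bitDistance false true  = 1
bitDistance true  false = 1

hamming : ∀ {k} → BStr k → BStr k → ℕ
hamming []       []       = 0
hamming (x ∷ u) (y ∷ v) = bitDistance x y + hamming u v

hamming-refl : ∀ {k} (u : BStr k) → hamming u u ≡ 0
hamming-refl []            = refl
hamming-refl (false ∷ u) = hamming-refl u
hamming-refl (true  ∷ u) = hamming-refl u

flip : ∀ {k} → Fin k → BStr k → BStr k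
flip zero    (x ∷ u) = not x ∷ u
flip (suc i) (x ∷ u) = x ∷ flip i u

flip-involutive : ∀ {k} (i : Fin k) (u : BStr k) → flip i (flip i u) ≡ u
flip-involutive zero    (x ∷ u) = cong (_∷ u) (BP.not-involutive x)
flip-involutive (suc i) (x ∷ u) = cong (x ∷_) (flip-involutive i u)

flip-injective : ∀ {k} (i : Fin k) → Injective _≡_ _≡_ (flip i)
flip-injective i {u} {v} e =
  trans (sym (flip-involutive i u)) (trans (cong (flip i) e) (flip-involutive i v))

lookup-flip : ∀ {k} (i : Fin k) (u : BStr k) → lookup (flip i u) i ≡ not (lookup u i)
lookup-flip zero    (x ∷ u) = refl
lookup-flip (suc i) (x ∷ u) = lookup-flip i u

hamming-flip-flip : ∀ {k} (i : Fin k) (u v : BStr k) →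
  hamming (flip i u) (flip i v) ≡ hamming u v
hamming-flip-flip zero    (x ∷ u) (y ∷ v) = cong (_+ hamming u v) (not-not x y)
  where
  not-not : ∀ x y → bitDistance (not x) (not y) ≡ bitDistance x y
  not-not false false = refl
  not-not false true  = refl
  not-not true  false = refl
  not-not true  true  = refl
hamming-flip-flip (suc i) (x ∷ u) (y ∷ v) = cong (bitDistance x y +_) (hamming-flip-flip i u v)

hamming-flip-agree : ∀ {k} (i : Fin k) (u w : BStr k) → lookup w i ≡ lookup u i →
  hamming (flip i u) w ≡ suc (hamming u w)
hamming-flip-agree zero (false ∷ u) (.false ∷ w) refl = refl
hamming-flip-agree zero (true  ∷ u) (.true  ∷ w) refl = refl
hamming-flip-agree (suc i) (x ∷ u) (y ∷ w) e =
  trans (cong (bitDistance x y +_) (hamming-flip-agree i u w e)) (+-suc (bitDistance x y) (hamming u w))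

hamming-flip-disagree : ∀ {k} (i : Fin k) (u w : BStr k) → lookup w i ≢ lookup u i →
  hamming u w ≡ suc (hamming (flip i u) w)
hamming-flip-disagree i u w ne = begin
  hamming u w                     ≡⟨ cong (λ v → hamming v w) (sym (flip-involutive i u)) ⟩
  hamming (flip i (flip i u)) w   ≡⟨ hamming-flip-agree i (flip i u) w w-agrees ⟩
  suc (hamming (flip i u) w)      ∎
  where
  open ≡-Reasoning
  w-agrees : lookup w i ≡ lookup (flip i u) i
  w-agrees = trans (BP.¬-not ne) (sym (lookup-flip i u))

lookup-flip-other : ∀ {k} (i j : Fin k) (u : BStr k) → j ≢ i → lookup (flip i u) j ≡ lookup u j
lookup-flip-other zero    zero    u       j≢i = contradiction refl j≢i
lookup-flip-other zero    (suc j) (x ∷ u) _   = refl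
lookup-flip-other (suc i) zero    (x ∷ u) _   = refl
lookup-flip-other (suc i) (suc j) (x ∷ u) j≢i = lookup-flip-other i j u (λ e → j≢i (cong suc e))

vec-ext : ∀ {k} {u v : BStr k} → (∀ j → lookup u j ≡ lookup v j) → u ≡ v
vec-ext {u = u} {v} e = trans (sym (tabulate∘lookup u)) (trans (tabulate-cong e) (tabulate∘lookup v))

flip-adjacent : ∀ {k} (i : Fin k) (u : BStr k) → Adj u (flip i u)
flip-adjacent i u =
  i , (λ e → BP.not-¬ refl (trans e (lookup-flip i u))) , λ j j≢i → sym (lookup-flip-other i j u j≢i)

adjacent⇒flip : ∀ {k} {u v : BStr k} → Adj u v → Σ (Fin k) λ i → v ≡ flip i u
adjacent⇒flip {u = u} {v} (i , ne , eq) = i , vec-ext agree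
  where
  agree : ∀ j → lookup v j ≡ lookup (flip i u) j
  agree j with j ≟ᶠ i
  ... | yes refl = trans (BP.¬-not (λ e → ne (sym e))) (sym (lookup-flip i u))
  ... | no j≢i   = trans (sym (eq j j≢i)) (sym (lookup-flip-other i j u j≢i))

DownClosed : ∀ {k} → (BStr k → Set) → Set
DownClosed {k} P = ∀ {u v : BStr k} → u ≼ v → P v → P u

≼-refl : ∀ {k} {u : BStr k} → u ≼ u
≼-refl = PW.refl BP.≤-refl

≼-trans : ∀ {k} {u v w : BStr k} → u ≼ v → v ≼ w → u ≼ w
≼-trans = PW.trans BP.≤-trans

daisy-downClosed : ∀ {n} (X : List (BStr n)) → DownClosed (InDaisy X)
daisy-downClosed X u≼v (x , x∈X , v≼x) = x , x∈X , ≼-trans u≼v v≼x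

full-downClosed : ∀ {k} → DownClosed (Full {k})
full-downClosed _ _ = tt

tail-downClosed : ∀ {k} {P : BStr (suc k) → Set} (x : Bool) →
  DownClosed P → DownClosed (λ w → P (x ∷ w))
tail-downClosed x down u≼v = down (BP.≤-refl PW.∷ u≼v)

hamming-step : ∀ {k} {u v : BStr k} (w : BStr k) → Adj u v → hamming u w ≤ suc (hamming v w)
hamming-step {u = u} {v} w adj with adjacent⇒flip {u = u} {v} adj
... | i , refl with lookup w i ≟ᵇ lookup u i
...   | yes agree = ≤-trans (n≤1+n _)
                      (≤-trans (≤-reflexive (sym (hamming-flip-agree i u w agree))) (n≤1+n _))
...   | no disagree = ≤-reflexive (hamming-flip-disagree i u w disagree)

hamming≤walk : ∀ {k} {P : BStr k → Set} {u v m} → Walk P u v m → hamming u v ≤ m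
hamming≤walk {u = u} (here _) = ≤-reflexive (hamming-refl u)
hamming≤walk {u = u} {v} (step {v = u′} _ adj rest) =
  ≤-trans (hamming-step {u = u} {u′} v adj) (s≤s (hamming≤walk rest))

adjacent-cons : ∀ {k} (x : Bool) {u v : BStr k} → Adj u v → Adj (x ∷ u) (x ∷ v)
adjacent-cons x {u} {v} adj with adjacent⇒flip {u = u} {v} adj
... | i , refl = flip-adjacent (suc i) (x ∷ u)

walk-cons : ∀ {k} {P : BStr (suc k) → Set} (x : Bool) {u v : BStr k} {m} →
  Walk (λ w → P (x ∷ w)) u v m → Walk P (x ∷ u) (x ∷ v) m
walk-cons x (here p)          = here p
walk-cons x (step p adj rest) = step p (adjacent-cons x adj) (walk-cons x rest)

walk-snoc : ∀ {k} {P : BStr k → Set} {u v w m} → Walk P u v m → P w → Adj v w → Walk P u w (suc m)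
walk-snoc (here p)          pw adj = step p adj (here pw)
walk-snoc (step p adj rest) pw adj′ = step p adj (walk-snoc rest pw adj′)

-- Inside a down-closed set, any two members are joined by a walk of Hamming length:
-- clear the differing bits of u first, then set those of v.
geodesic : ∀ {k} (P : BStr k → Set) → DownClosed P → ∀ u v → P u → P v → Walk P u v (hamming u v)
geodesic P down []            []            pu pv = here pu
geodesic P down (false ∷ u) (false ∷ v) pu pv =
  walk-cons false (geodesic _ (tail-downClosed false down) u v pu pv)
geodesic P down (true ∷ u)  (true ∷ v)  pu pv =
  walk-cons true (geodesic _ (tail-downClosed true down) u v pu pv)
geodesic P down (true ∷ u)  (false ∷ v) pu pv =
  step pu (flip-adjacent zero (true ∷ u))
    (walk-cons false (geodesic _ (tail-downClosed false down) u v (down (B.f≤t PW.∷ ≼-refl) pu) pv))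
geodesic P down (false ∷ u) (true ∷ v)  pu pv =
  walk-snoc (walk-cons false (geodesic _ (tail-downClosed false down) u v pu (down (B.f≤t PW.∷ ≼-refl) pv)))
    pv (flip-adjacent zero (false ∷ v))

distance≡hamming : ∀ {k} (P : BStr k → Set) → DownClosed P → ∀ {u v} → P u → P v → ∀ m →
  Dist P u v m ⇔ (m ≡ hamming u v)
distance≡hamming P down {u} {v} pu pv m = mk⇔ to from
  where
  to : Dist P u v m → m ≡ hamming u v
  to (walk , shortest) with m ≤? hamming u v
  ... | yes m≤h = ≤-antisym m≤h (hamming≤walk walk)
  ... | no  m≰h = ⊥-elim (shortest (hamming u v) (≰⇒> m≰h) (geodesic P down u v pu pv))
  from : m ≡ hamming u v → Dist P u v m
  from refl = geodesic P down u v pu pv , λ m′ m′<m walk → <⇒≱ m′<m (hamming≤walk walk)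

daisy-distance : ∀ {n} (X : List (BStr n)) {u v : BStr n} → InDaisy X u → InDaisy X v → ∀ m →
  Dist (InDaisy X) u v m ⇔ (m ≡ hamming u v)
daisy-distance X = distance≡hamming (InDaisy X) (daisy-downClosed X)

-- A map preserving Hamming distance is a labelling of every daisy cube, because
-- distances in the daisy cube and in Q_k are both Hamming distances.
isometry⇒labelling : ∀ {n k} (X : List (BStr n)) (φ : BStr n → BStr k) →
  (∀ u v → hamming (φ u) (φ v) ≡ hamming u v) → IsLabelling X φ
isometry⇒labelling X φ isometry u v du dv m = mk⇔
  (λ d → from distQ (trans (to distG d) (sym (isometry u v))))
  (λ d → from distG (trans (to distQ d) (isometry u v)))
  where
  open Equivalence
  distG : Dist (InDaisy X) u v m ⇔ (m ≡ hamming u v)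
  distG = daisy-distance X du dv m
  distQ : Dist Full (φ u) (φ v) m ⇔ (m ≡ hamming (φ u) (φ v))
  distQ = distance≡hamming Full full-downClosed tt tt m

halfspace : ∀ {n} (X : List (BStr n)) {a b : BStr n} (i : Fin n) →
  InDaisy X a → InDaisy X b → b ≡ flip i a →
  ∀ w → W X a b w ⇔ (InDaisy X w × lookup w i ≡ lookup a i)
halfspace X {a} i da db refl w = mk⇔ to from
  where
  to : W X a (flip i a) w → InDaisy X w × lookup w i ≡ lookup a i
  to (dw , m , m′ , a-w , b-w , m<m′) with lookup w i ≟ᵇ lookup a i
  ... | yes agree    = dw , agree
  ... | no  disagree = contradiction (≤-trans (n≤1+n m′) (≤-reflexive (sym m≡1+m′))) (<⇒≱ m<m′)
    where
    open ≡-Reasoning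
    m≡1+m′ : m ≡ suc m′
    m≡1+m′ = begin
      m                               ≡⟨ Equivalence.to (daisy-distance X da dw m) a-w ⟩
      hamming a w                     ≡⟨ hamming-flip-disagree i a w disagree ⟩
      suc (hamming (flip i a) w)      ≡⟨ cong suc (sym (Equivalence.to (daisy-distance X db dw m′) b-w)) ⟩
      suc m′                          ∎
  from : InDaisy X w × lookup w i ≡ lookup a i → W X a (flip i a) w
  from (dw , agree) =
    dw , hamming a w , hamming (flip i a) w ,
    Equivalence.from (daisy-distance X da dw _) refl ,
    Equivalence.from (daisy-distance X db dw _) refl ,
    ≤-reflexive (sym (hamming-flip-agree i a w agree))

unique-⊆⇒length≤ : ∀ {A : Set} {xs ys : List A} → Unique xs → xs ⊆ ys → length xs ≤ length ys
unique-⊆⇒length≤ {xs = []}     _                _   = z≤n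
unique-⊆⇒length≤ {xs = x ∷ xs} (x∉xs ∷ unique) sub with ∈-∃++ (sub (here refl))
... | ys , zs , refl =
  ≤-trans (s≤s (unique-⊆⇒length≤ unique sub′)) (≤-reflexive (sym (length-++-sucʳ ys x zs)))
  where
  sub′ : xs ⊆ ys ++ zs
  sub′ {y} y∈xs with ∈-++⁻ ys (sub (there y∈xs))
  ... | inj₁ y∈ys         = ∈-++⁺ˡ y∈ys
  ... | inj₂ (here y≡x)   = ⊥-elim (All.lookup x∉xs y∈xs (sym y≡x))
  ... | inj₂ (there y∈zs) = ∈-++⁺ʳ ys y∈zs

unique-⊆-length≥⇒⊇ : ∀ {A : Set} → DecidableEquality A → {xs ys : List A} →
  Unique xs → xs ⊆ ys → length ys ≤ length xs → ys ⊆ xs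
unique-⊆-length≥⇒⊇ _≟_ {xs} unique sub ys≤xs {w} w∈ys with DecMembership._∈?_ _≟_ w xs
... | yes w∈xs = w∈xs
... | no  w∉xs = contradiction ys≤xs
      (<⇒≱ (unique-⊆⇒length≤ (All.tabulate (λ y∈xs w≡y → w∉xs (subst (_∈ xs) (sym w≡y) y∈xs)) ∷ unique)
                              λ { (here refl) → w∈ys ; (there y∈xs) → sub y∈xs }))

injection-onto : ∀ {n m} {S : BStr n → Set} {T : BStr m → Set} {c d : ℕ} →
  HasCard S c → HasCard T d → d ≤ c →
  (f : BStr n → BStr m) → Injective _≡_ _≡_ f → (∀ x → S x → T (f x)) →
  ∀ y → T y → ∃ λ x → S x × f x ≡ y
injection-onto (listS , uniqueS , memberS , refl) (listT , _ , memberT , refl) d≤c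
               f injective maps y ty
  with ∈-map⁻ f (unique-⊆-length≥⇒⊇ (≡-dec _≟ᵇ_) (UniqueProperties.map⁺ injective uniqueS) image⊆T T≤image
                   (Equivalence.from (memberT y) ty))
  where
  image⊆T : map f listS ⊆ listT
  image⊆T y∈image with ∈-map⁻ f y∈image
  ... | x , x∈S , refl = Equivalence.from (memberT (f x)) (maps x (Equivalence.to (memberS x) x∈S))
  T≤image : length listT ≤ length (map f listS)
  T≤image = ≤-trans d≤c (≤-reflexive (sym (length-map f listS)))
... | x , x∈S , y≡fx = x , Equivalence.to (memberS x) x∈S , sym y≡fx

zeros-≼ : ∀ {k} (v : BStr k) → zeros k ≼ v
zeros-≼ []      = PW.[]
zeros-≼ (x ∷ v) = BP.≤-minimum x PW.∷ zeros-≼ v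

zeros-in-daisy : ∀ {n} (X : List (BStr n)) {a : BStr n} → InDaisy X a → InDaisy X (zeros n)
zeros-in-daisy X {a} da = daisy-downClosed X (zeros-≼ a) da

flip-set-≼ : ∀ {k} (i : Fin k) (u : BStr k) → lookup u i ≡ true → flip i u ≼ u
flip-set-≼ zero    (true ∷ u) refl = B.f≤t PW.∷ ≼-refl
flip-set-≼ (suc i) (x ∷ u)    u-bit = BP.≤-refl PW.∷ flip-set-≼ i u u-bit

≼-flip-set : ∀ {k} (i : Fin k) (y u : BStr k) → y ≼ flip i u → lookup y i ≡ true → flip i y ≼ u
≼-flip-set zero    (true ∷ y) (false ∷ u) (_ PW.∷ y≼u)  refl  = B.b≤b PW.∷ y≼u
≼-flip-set zero    (true ∷ y) (true ∷ u)  (() PW.∷ _)   refl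
≼-flip-set (suc i) (x ∷ y)    (z ∷ u)     (x≤z PW.∷ y≼) y-bit = x≤z PW.∷ ≼-flip-set i y u y≼ y-bit

≼-flip-clear : ∀ {k} (i : Fin k) (y u : BStr k) → y ≼ flip i u → lookup y i ≡ false → y ≼ u
≼-flip-clear zero    (false ∷ y) (z ∷ u) (_ PW.∷ y≼u)  refl  = BP.≤-minimum z PW.∷ y≼u
≼-flip-clear (suc i) (x ∷ y)     (z ∷ u) (x≤z PW.∷ y≼) y-bit = x≤z PW.∷ ≼-flip-clear i y u y≼ y-bit

identity-proper : ∀ {n} (X : List (BStr n)) → IsProper X id
identity-proper X u du y y≼u = y , daisy-downClosed X y≼u du , refl

flip-proper : ∀ {n} (X : List (BStr n)) (i : Fin n) →
  (∀ w → InDaisy X w → lookup w i ≡ false → InDaisy X (flip i w)) → IsProper X (flip i)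
flip-proper X i closed u du y y≼ = flip i y , flip-y-in-daisy , flip-involutive i y
  where
  flip-y-in-daisy : InDaisy X (flip i y)
  flip-y-in-daisy with lookup y i in y-bit
  ... | true  = daisy-downClosed X (≼-flip-set i y u y≼ y-bit) du
  ... | false = closed y (daisy-downClosed X (≼-flip-clear i y u y≼ y-bit) du) y-bit

-- The key step: if a_i = 1 and |W_ba| ≤ |W_ab| for b = flip i a, then clearing bit i
-- maps W_ab injectively into W_ba, hence onto it, so every vertex with bit i clear
-- (an element of W_ba) can have bit i set inside the daisy cube.
setting-bit-stays-in-daisy : ∀ {n} (X : List (BStr n)) {a : BStr n} (i : Fin n) {ca cb : ℕ} →
  InDaisy X a → InDaisy X (flip i a) → lookup a i ≡ true →
  HasCard (W X a (flip i a)) ca → HasCard (W X (flip i a) a) cb → cb ≤ ca →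
  ∀ w → InDaisy X w → lookup w i ≡ false → InDaisy X (flip i w)
setting-bit-stays-in-daisy X {a} i da db a-bit cardAB cardBA cb≤ca w dw w-bit =
  set-bit (injection-onto cardAB cardBA cb≤ca (flip i) (flip-injective i) clear-bit w
             (Equivalence.from (W-ba w) (dw , trans w-bit (sym b-bit))))
  where
  W-ab : ∀ x → W X a (flip i a) x ⇔ (InDaisy X x × lookup x i ≡ lookup a i)
  W-ab = halfspace X i da db refl
  W-ba : ∀ x → W X (flip i a) a x ⇔ (InDaisy X x × lookup x i ≡ lookup (flip i a) i)
  W-ba = halfspace X i db da (sym (flip-involutive i a))
  b-bit : lookup (flip i a) i ≡ false
  b-bit = trans (lookup-flip i a) (cong not a-bit)
  clear-bit : ∀ x → W X a (flip i a) x → W X (flip i a) a (flip i x)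
  clear-bit x x∈W with Equivalence.to (W-ab x) x∈W
  ... | dx , x-bit = Equivalence.from (W-ba (flip i x))
          ( daisy-downClosed X (flip-set-≼ i x (trans x-bit a-bit)) dx
          , trans (lookup-flip i x) (trans (cong not (trans x-bit a-bit)) (sym b-bit)))
  set-bit : (∃ λ x → W X a (flip i a) x × flip i x ≡ w) → InDaisy X (flip i w)
  set-bit (x , x∈W , refl) = subst (InDaisy X) (sym (flip-involutive i x)) (proj₁ (Equivalence.to (W-ab x) x∈W))

corollary3p3 : ∀ (n : ℕ) (X : List (BStr n)) (a b : BStr n) →
    InDaisy X a → InDaisy X b → Adj a b →
    (Σ ℕ λ ca → Σ ℕ λ cb → HasCard (W X a b) ca × HasCard (W X b a) cb × cb ≤ ca) →
    Σ ℕ λ k → Σ (BStr n → BStr k) λ φ →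
    IsLabelling X φ × IsProper X φ ×
    (∃ λ z → W X a b z × φ z ≡ zeros k)
corollary3p3 n X a b da db adj (ca , cb , cardAB , cardBA , cb≤ca) with adjacent⇒flip {u = a} {b} adj
... | i , refl with lookup a i in a-bit
...   | false = n , id , isometry⇒labelling X id (λ _ _ → refl) , identity-proper X ,
        zeros n , Equivalence.from (halfspace X i da db refl (zeros n)) (zeros-in-daisy X da , zeros-bit) ,
        refl
  where
  zeros-bit : lookup (zeros n) i ≡ lookup a i
  zeros-bit = trans (lookup-replicate i false) (sym a-bit)
...   | true  = n , flip i , isometry⇒labelling X (flip i) (hamming-flip-flip i) , flip-proper X i set-bit ,
        flip i (zeros n) , Equivalence.from (halfspace X i da db refl (flip i (zeros n))) (flipped-in-daisy , flipped-bit) ,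
        flip-involutive i (zeros n)
  where
  set-bit : ∀ w → InDaisy X w → lookup w i ≡ false → InDaisy X (flip i w)
  set-bit = setting-bit-stays-in-daisy X i da db a-bit cardAB cardBA cb≤ca
  flipped-in-daisy : InDaisy X (flip i (zeros n))
  flipped-in-daisy = set-bit (zeros n) (zeros-in-daisy X da) (lookup-replicate i false)
  flipped-bit : lookup (flip i (zeros n)) i ≡ lookup a i
  flipped-bit = trans (lookup-flip i (zeros n)) (trans (cong not (lookup-replicate i false)) (sym a-bit))
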